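{- Let $m\geq 3$ be an integer and let $G\in RHL_m$ be an $m$-dimensional restricted hypercube-like graph. Then $m-1\leq fsmp(G)\leq m$.
   Context: For disjoint graphs $G_0,G_1$ of the same order and a bijection $\phi:V(G_0)\to V(G_1)$, $G_0\oplus_\phi G_1$ is the graph with vertex set $V(G_0)\cup V(G_1)$ and edge set $E(G_0)\cup E(G_1)\cup\{v\phi(v): v\in V(G_0)\}$. $G(8,4)$ is the graph with vertex set $\{v_0,\dots,v_7\}$ and edges $v_iv_j$ whenever $j\equiv i+1$ or $j\equiv i+4 \pmod 8$. The restricted hypercube-like graphs: $RHL_3=\{G(8,4)\}$ (up to isomorphism) and, for $m\geq 4$, $RHL_m=\{G_0\oplus_\phi G_1 : G_0,G_1\in RHL_{m-1},\ \phi \text{ a bijection}\}$. A fractional perfect matching of a graph $H$ is a function $f:E(H)\to[0,1]$ with $\sum_{e\ni v}f(e)=1$ for every vertex $v$. A set $F$ of vertices and/or edges of $H$ is a fractional strong matching preclusion (FSMP) set if $H-F$ (deleting the vertices with their incident edges, and the edges) has no fractional perfect matching; $fsmp(H)$ is the minimum size of an FSMP set.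
   Formalization: The fractional perfect matchings of each graph H−F take values in the rationals in [0,1], not in the real interval [0,1]. -}

module Defs where

open import Data.Nat using (ℕ; zero; suc; _+_; _≤_; _∸_; _≡ᵇ_; _%_)
open import Data.Fin using (Fin; toℕ; splitAt; _≟_)
open import Data.Bool using (Bool; true; false; _∧_; _∨_; not; if_then_else_)
open import Data.Sum using (_⊎_; inj₁; inj₂)
open import Data.Product using (Σ; _×_; _,_)
open import Data.List using (List; length)
open import Data.Bool.ListAction using (any)
open import Data.List.Relation.Unary.All using (All)
open import Data.Unit using (⊤)
open import Data.Rational using (ℚ; 0ℚ; 1ℚ) renaming (_+_ to _+ℚ_; _≤_ to _≤ℚ_)
open import Function.Bundles using (_↔_; Inverse)
open import Relation.Nullary using (¬_; does)
open import Relation.Binary.PropositionalEquality using (_≡_)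

-- A (simple) graph on vertex set Fin n, given by a Boolean adjacency relation.
-- (Symmetry/irreflexivity is automatic for all graphs in RHL_m, see RHL below.)
Graph : ℕ → Set
Graph n = Fin n → Fin n → Bool

_==_ : ∀ {n} → Fin n → Fin n → Bool
a == b = does (a ≟ b)

record _≅_ {k n : ℕ} (G : Graph k) (H : Graph n) : Set where
  field
    σ    : Fin k ↔ Fin n
    pres : ∀ u v → G u v ≡ H (Inverse.to σ u) (Inverse.to σ v)

G84 : Graph 8
G84 i j = ((suc (toℕ i) % 8) ≡ᵇ toℕ j)
        ∨ ((suc (toℕ j) % 8) ≡ᵇ toℕ i)
        ∨ (((toℕ i + 4) % 8) ≡ᵇ toℕ j)

_⊕[_]_ : ∀ {n} → Graph n → (Fin n ↔ Fin n) → Graph n → Graph (n + n)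
_⊕[_]_ {n} G0 φ G1 x y with splitAt n x | splitAt n y
... | inj₁ a | inj₁ b = G0 a b
... | inj₂ a | inj₂ b = G1 a b
... | inj₁ a | inj₂ b = Inverse.to φ a == b
... | inj₂ b | inj₁ a = Inverse.to φ a == b

data RHL : ℕ → ∀ {k} → Graph k → Set where
  base : ∀ {k} {G : Graph k} → G ≅ G84 → RHL 3 G
  step : ∀ {m n k} {G0 G1 : Graph n} {G : Graph k} →
         RHL m G0 → RHL m G1 → (φ : Fin n ↔ Fin n) →
         G ≅ (G0 ⊕[ φ ] G1) → RHL (suc m) G

sumFin : ∀ n → (Fin n → ℚ) → ℚ
sumFin zero    f = 0ℚ
sumFin (suc n) f = f Fin.zero +ℚ sumFin n (λ i → f (Fin.suc i))

-- A deletion set: vertices (inj₁ v) and/or edges (inj₂ (a , b) standing for edge ab)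
DelSet : ℕ → Set
DelSet n = List (Fin n ⊎ (Fin n × Fin n))

module _ {n : ℕ} (G : Graph n) (F : DelSet n) where

  ValidDel : Set
  ValidDel = All ok F
    where
      ok : Fin n ⊎ (Fin n × Fin n) → Set
      ok (inj₁ _) = ⊤
      ok (inj₂ (a , b)) = G a b ≡ true

  delV : Fin n → Bool
  delV v = any isV F
    where
      isV : Fin n ⊎ (Fin n × Fin n) → Bool
      isV (inj₁ x) = x == v
      isV (inj₂ _) = false

  delE : Fin n → Fin n → Bool
  delE u v = any isE F
    where
      isE : Fin n ⊎ (Fin n × Fin n) → Bool
      isE (inj₁ _) = false
      isE (inj₂ (a , b)) = (a == u ∧ b == v) ∨ (a == v ∧ b == u)

  liveEdge : Fin n → Fin n → Bool
  liveEdge u v = G u v ∧ not (delV u) ∧ not (delV v) ∧ not (delE u v)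

  HasFPM : Set
  HasFPM = Σ (Fin n → Fin n → ℚ) λ w →
      (∀ u v → w u v ≡ w v u)
    × (∀ u v → liveEdge u v ≡ true → (0ℚ ≤ℚ w u v) × (w u v ≤ℚ 1ℚ))
    × (∀ v → delV v ≡ false →
         sumFin n (λ u → if liveEdge v u then w v u else 0ℚ) ≡ 1ℚ)

  FSMPSet : Set
  FSMPSet = ValidDel × ¬ HasFPM

-- Every vertex of a graph in RHL_m has degree m (G(8,4) is cubic and each join adds one rung per vertex),
-- so deleting the m edges at one vertex isolates it: fsmp ≤ m.
--
-- For fsmp ≥ m − 1 we show by induction on m that G − F has a fractional perfect matching whenever
-- |F| ≤ m − 2; for G(8,4) this is a finite check. Let G = G0 ⊕φ G1 with G0, G1 ∈ RHL_m and |F| ≤ m − 1.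
-- If each copy receives at most m − 2 elements of F, matchings of the two copies with weight 0 on the rungs v φ(v) combine.
-- Otherwise F lies inside one copy, say F = F' + x in G0, and a matching of G0 − F' is repaired: the weight
-- carried by x is sent across the rungs and absorbed in G1 by matchings of G1 minus one or two vertices.
-- So deletions of two vertices belong to the induction hypothesis; for m = 3 they are also checked directly.
module Submission where

open import Defs
open import Algebra.Bundles using (CommutativeRing)
open import Data.Bool using (Bool; true; false; _∧_; _∨_; not; if_then_else_; T)
open import Data.Bool.ListAction using (or)
import Data.Bool.Properties as 𝔹
open import Data.Fin using (Fin; zero; suc; toℕ; _↑ˡ_; _↑ʳ_; _≟_; splitAt)
import Data.Fin.Properties as Fin
open import Data.List using (List; []; _∷_; length; map)
open import Data.List.Membership.Propositional using (_∈_)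
open import Data.List.Membership.Propositional.Properties using (∈-map⁺)
open import Data.List.Properties using (map-cong; length-map)
open import Data.List.Relation.Unary.All using (All; []; _∷_)
import Data.List.Relation.Unary.All as All
import Data.List.Relation.Unary.All.Properties as All
open import Data.List.Relation.Unary.Any using (here; there)
open import Data.Nat using (ℕ; zero; suc; _+_; _∸_; _%_; _≤_; _≤?_; _≡ᵇ_; s≤s; s≤s⁻¹; z≤n)
import Data.Nat.Properties as ℕ
open import Data.Product using (Σ; _×_; _,_)
import Data.Product as ×
open import Data.Rational using (ℚ; 0ℚ; 1ℚ; ½; nonNegative)
  renaming (_+_ to _+ℚ_; _*_ to _*ℚ_; _-_ to _-ℚ_; -_ to -ℚ_; _≤_ to _≤ℚ_)
import Data.Rational.Properties as ℚ
open import Data.Rational.Solver using (module +-*-Solver)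
open import Data.Sum using (inj₁; inj₂)
import Data.Sum as ⊎
open import Data.Unit using (tt)
open import Function.Base using (_∘_)
open import Function.Bundles using (_↔_; Inverse; Injection; mk↔ₛ′)
open import Function.Properties.Inverse using (↔⇒↣; ↔-sym)
open import Relation.Binary.PropositionalEquality
open import Relation.Nullary using (¬_; Dec; yes; no; contradiction)
open import Relation.Nullary.Decidable using (dec-true; dec-false)

open +-*-Solver using (solve; _:+_; _:-_; _:*_; con; _:=_)
open import Algebra.Properties.Semiring.Sum (CommutativeRing.semiring ℚ.+-*-commutativeRing)
  using (sum; sum-cong-≗; sum-replicate-zero; ∑-distrib-+; ∑-comm; *-distribˡ-sum; sum-permute)

-- Finite sums of rationals

sumFin≡sum : ∀ n (f : Fin n → ℚ) → sumFin n f ≡ sum f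
sumFin≡sum zero    f = refl
sumFin≡sum (suc n) f = cong (f zero +ℚ_) (sumFin≡sum n (λ i → f (suc i)))

sum-zero : ∀ {n} {f : Fin n → ℚ} → (∀ i → f i ≡ 0ℚ) → sum f ≡ 0ℚ
sum-zero {n} f≗0 = trans (sum-cong-≗ f≗0) (sum-replicate-zero n)

sum-↑ : ∀ n {m} (f : Fin (n + m) → ℚ) → sum f ≡ sum (λ i → f (i ↑ˡ m)) +ℚ sum (λ j → f (n ↑ʳ j))
sum-↑ zero    f = sym (ℚ.+-identityˡ _)
sum-↑ (suc n) f = trans (cong (f zero +ℚ_) (sum-↑ n (λ i → f (suc i)))) (sym (ℚ.+-assoc (f zero) _ _))

sum-nonNeg : ∀ {n} {f : Fin n → ℚ} → (∀ i → 0ℚ ≤ℚ f i) → 0ℚ ≤ℚ sum f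
sum-nonNeg {zero}  f≥0 = ℚ.≤-refl
sum-nonNeg {suc n} f≥0 = ℚ.+-mono-≤ (f≥0 zero) (sum-nonNeg (λ i → f≥0 (suc i)))

≤-sum : ∀ {n} {f : Fin n → ℚ} → (∀ i → 0ℚ ≤ℚ f i) → ∀ i → f i ≤ℚ sum f
≤-sum {suc n} {f} f≥0 zero =
  subst (_≤ℚ sum f) (ℚ.+-identityʳ (f zero)) (ℚ.+-monoʳ-≤ (f zero) (sum-nonNeg (λ i → f≥0 (suc i))))
≤-sum {suc n} {f} f≥0 (suc i) =
  subst (_≤ℚ sum f) (ℚ.+-identityˡ (f (suc i))) (ℚ.+-mono-≤ (f≥0 zero) (≤-sum (λ i → f≥0 (suc i)) i))

*-nonNeg : ∀ {p q} → 0ℚ ≤ℚ p → 0ℚ ≤ℚ q → 0ℚ ≤ℚ p *ℚ q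
*-nonNeg {p} {q} p≥0 q≥0 =
  ℚ.nonNegative⁻¹ (p *ℚ q) {{ℚ.nonNeg*nonNeg⇒nonNeg p {{nonNegative p≥0}} q {{nonNegative q≥0}}}}

if-0-nonNeg : ∀ c {p} → 0ℚ ≤ℚ p → 0ℚ ≤ℚ (if c then 0ℚ else p)
if-0-nonNeg true  _   = ℚ.≤-refl
if-0-nonNeg false p≥0 = p≥0

p≤q⇒0≤q-p : ∀ {p q} → p ≤ℚ q → 0ℚ ≤ℚ q -ℚ p
p≤q⇒0≤q-p {p} {q} p≤q = subst (_≤ℚ q -ℚ p) (ℚ.+-inverseʳ p) (ℚ.+-monoˡ-≤ (-ℚ p) p≤q)

not-flip : ∀ {x y} → not x ≡ y → x ≡ not y
not-flip {x} refl = sym (𝔹.not-involutive x)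

==-refl : ∀ {n} (a : Fin n) → (a == a) ≡ true
==-refl a = dec-true (a ≟ a) refl

≢⇒==-false : ∀ {n} {a b : Fin n} → ¬ a ≡ b → (a == b) ≡ false
≢⇒==-false {a = a} {b} = dec-false (a ≟ b)

==-true⇒≡ : ∀ {n} {a b : Fin n} → (a == b) ≡ true → a ≡ b
==-true⇒≡ {a = a} {b} eq with a ≟ b
... | yes a≡b = a≡b

==-sym : ∀ {n} (a b : Fin n) → (a == b) ≡ (b == a)
==-sym a b with a ≟ b
... | yes refl = sym (==-refl a)
... | no a≢b   = sym (≢⇒==-false (a≢b ∘ sym))

==-injective : ∀ {n k} (f : Fin n → Fin k) → (∀ {a b} → f a ≡ f b → a ≡ b) → ∀ a b → (f a == f b) ≡ (a == b)
==-injective f f-inj a b with a ≟ b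
... | yes refl = ==-refl (f a)
... | no a≢b   = ≢⇒==-false (λ fa≡fb → a≢b (f-inj fa≡fb))

sum-indicator : ∀ {n} (i : Fin n) (h : Fin n → ℚ) → sum (λ j → if i == j then h j else 0ℚ) ≡ h i
sum-indicator {suc n} zero h =
  trans (cong (h zero +ℚ_) (sum-zero {n} (λ _ → refl))) (ℚ.+-identityʳ (h zero))
sum-indicator {suc n} (suc i) h =
  trans (cong (0ℚ +ℚ_) (sum-indicator i (λ j → h (suc j)))) (ℚ.+-identityˡ (h (suc i)))

sum-remove : ∀ {n} (i : Fin n) (h : Fin n → ℚ) → sum h ≡ sum (λ j → if i == j then 0ℚ else h j) +ℚ h i
sum-remove i h = begin
  sum h                       ≡⟨ sum-cong-≗ split ⟩
  sum (λ j → rest j +ℚ at j)  ≡⟨ ∑-distrib-+ rest at ⟩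
  sum rest +ℚ sum at          ≡⟨ cong (sum rest +ℚ_) (sum-indicator i h) ⟩
  sum rest +ℚ h i             ∎
  where
    open ≡-Reasoning
    rest at : Fin _ → ℚ
    rest j = if i == j then 0ℚ else h j
    at j = if i == j then h j else 0ℚ
    split : ∀ j → h j ≡ rest j +ℚ at j
    split j with i == j
    ... | true  = sym (ℚ.+-identityˡ (h j))
    ... | false = sym (ℚ.+-identityʳ (h j))

-- Deletion sets and fractional perfect matchings

-- Structural forms of delV and delE: those test membership through a where-bound predicate under any,
-- so they do not unfold along the list.
vertexDeleted : ∀ {n} → DelSet n → Fin n → Bool
vertexDeleted []            v = false
vertexDeleted (inj₁ x ∷ F) v = (x == v) ∨ vertexDeleted F v
vertexDeleted (inj₂ _ ∷ F) v = vertexDeleted F v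

coversEdge : ∀ {n} → Fin n × Fin n → Fin n → Fin n → Bool
coversEdge (a , b) u v = (a == u ∧ b == v) ∨ (a == v ∧ b == u)

edgeDeleted : ∀ {n} → DelSet n → Fin n → Fin n → Bool
edgeDeleted []            u v = false
edgeDeleted (inj₁ _ ∷ F) u v = edgeDeleted F u v
edgeDeleted (inj₂ e ∷ F) u v = coversEdge e u v ∨ edgeDeleted F u v

live : ∀ {n} → Graph n → DelSet n → Fin n → Fin n → Bool
live G F u v = G u v ∧ not (vertexDeleted F u) ∧ not (vertexDeleted F v) ∧ not (edgeDeleted F u v)

delV≡vertexDeleted : ∀ {n} (G : Graph n) F v → delV G F v ≡ vertexDeleted F v
delV≡vertexDeleted G []            v = refl
delV≡vertexDeleted G (inj₁ x ∷ F) v =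
  cong ((x == v) ∨_) (trans (cong or (map-cong (λ { (inj₁ _) → refl ; (inj₂ _) → refl }) F)) (delV≡vertexDeleted G F v))
delV≡vertexDeleted G (inj₂ _ ∷ F) v =
  trans (cong or (map-cong (λ { (inj₁ _) → refl ; (inj₂ _) → refl }) F)) (delV≡vertexDeleted G F v)

delE≡edgeDeleted : ∀ {n} (G : Graph n) F u v → delE G F u v ≡ edgeDeleted F u v
delE≡edgeDeleted G []            u v = refl
delE≡edgeDeleted G (inj₁ _ ∷ F) u v =
  trans (cong or (map-cong (λ { (inj₁ _) → refl ; (inj₂ _) → refl }) F)) (delE≡edgeDeleted G F u v)
delE≡edgeDeleted G (inj₂ e ∷ F) u v =
  cong (coversEdge e u v ∨_)
       (trans (cong or (map-cong (λ { (inj₁ _) → refl ; (inj₂ _) → refl }) F)) (delE≡edgeDeleted G F u v))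

liveEdge≡live : ∀ {n} (G : Graph n) F u v → liveEdge G F u v ≡ live G F u v
liveEdge≡live G F u v
  rewrite delV≡vertexDeleted G F u | delV≡vertexDeleted G F v | delE≡edgeDeleted G F u v = refl

live-nonEdge : ∀ {n} (G : Graph n) F u v → G u v ≡ false → live G F u v ≡ false
live-nonEdge G F u v no-edge rewrite no-edge = refl

live-deletedˡ : ∀ {n} (G : Graph n) F u v → vertexDeleted F u ≡ true → live G F u v ≡ false
live-deletedˡ G F u v u∈F rewrite u∈F = 𝔹.∧-zeroʳ (G u v)

live-deletedʳ : ∀ {n} (G : Graph n) F u v → vertexDeleted F v ≡ true → live G F u v ≡ false
live-deletedʳ G F u v v∈F rewrite v∈F =
  trans (cong (G u v ∧_) (𝔹.∧-zeroʳ (not (vertexDeleted F u)))) (𝔹.∧-zeroʳ (G u v))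

live-edgeDeleted : ∀ {n} (G : Graph n) F u v → edgeDeleted F u v ≡ true → live G F u v ≡ false
live-edgeDeleted G F u v uv∈F rewrite uv∈F =
  trans (cong (λ x → G u v ∧ (not (vertexDeleted F u) ∧ x)) (𝔹.∧-zeroʳ (not (vertexDeleted F v))))
        (trans (cong (G u v ∧_) (𝔹.∧-zeroʳ (not (vertexDeleted F u)))) (𝔹.∧-zeroʳ (G u v)))

-- A fractional perfect matching of G − F, extended by zero to all pairs; the bound weight ≤ 1 demanded
-- by HasFPM follows from nonnegativity and degree-one.
record FracPerfectMatching {n} (G : Graph n) (F : DelSet n) : Set where
  field
    weight      : Fin n → Fin n → ℚ
    weight-sym  : ∀ u v → weight u v ≡ weight v u
    weight-nonNeg : ∀ u v → 0ℚ ≤ℚ weight u v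
    weight-dead : ∀ u v → live G F u v ≡ false → weight u v ≡ 0ℚ
    degree-one  : ∀ v → vertexDeleted F v ≡ false → sum (weight v) ≡ 1ℚ

  degree-zero : ∀ v → vertexDeleted F v ≡ true → sum (weight v) ≡ 0ℚ
  degree-zero v v∈F = sum-zero (λ u → weight-dead v u (live-deletedˡ G F v u v∈F))

open FracPerfectMatching

live⇒undeleted : ∀ {n} (G : Graph n) F u v → live G F u v ≡ true → vertexDeleted F u ≡ false
live⇒undeleted G F u v uv-live with G u v | vertexDeleted F u
... | true | false = refl

toHasFPM : ∀ {n} {G : Graph n} {F : DelSet n} → FracPerfectMatching G F → HasFPM G F
toHasFPM {n} {G} {F} M = weight M , weight-sym M , bounds , degree
  where
    bounds : ∀ u v → liveEdge G F u v ≡ true → (0ℚ ≤ℚ weight M u v) × (weight M u v ≤ℚ 1ℚ)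
    bounds u v uv-live = weight-nonNeg M u v , subst (weight M u v ≤ℚ_) (degree-one M u u-kept) (≤-sum (weight-nonNeg M u) v)
      where u-kept = live⇒undeleted G F u v (trans (sym (liveEdge≡live G F u v)) uv-live)
    degree : ∀ v → delV G F v ≡ false → sumFin n (λ u → if liveEdge G F v u then weight M v u else 0ℚ) ≡ 1ℚ
    degree v v-kept = begin
      sumFin n (λ u → if liveEdge G F v u then weight M v u else 0ℚ) ≡⟨ sumFin≡sum n _ ⟩
      sum (λ u → if liveEdge G F v u then weight M v u else 0ℚ)      ≡⟨ sum-cong-≗ restrict ⟩
      sum (weight M v)                                               ≡⟨ degree-one M v (trans (sym (delV≡vertexDeleted G F v)) v-kept) ⟩
      1ℚ                                                             ∎
      where
        open ≡-Reasoning
        restrict : ∀ u → (if liveEdge G F v u then weight M v u else 0ℚ) ≡ weight M v u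
        restrict u rewrite liveEdge≡live G F v u with live G F v u in dead
        ... | true  = refl
        ... | false = sym (weight-dead M v u dead)

isolated⇒¬HasFPM : ∀ {n} (G : Graph n) F v → vertexDeleted F v ≡ false → (∀ u → live G F v u ≡ false) → ¬ HasFPM G F
isolated⇒¬HasFPM {n} G F v v-kept v-isolated (w , _ , _ , degree) = 0≢1 (begin
  0ℚ                                                       ≡⟨ sum-zero vanish ⟨
  sum (λ u → if liveEdge G F v u then w v u else 0ℚ)       ≡⟨ sumFin≡sum n _ ⟨
  sumFin n (λ u → if liveEdge G F v u then w v u else 0ℚ)  ≡⟨ degree v (trans (delV≡vertexDeleted G F v) v-kept) ⟩
  1ℚ                                                       ∎)
  where
    open ≡-Reasoning
    0≢1 : ¬ 0ℚ ≡ 1ℚ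
    0≢1 ()
    vanish : ∀ u → (if liveEdge G F v u then w v u else 0ℚ) ≡ 0ℚ
    vanish u rewrite liveEdge≡live G F v u | v-isolated u = refl

mapDel : ∀ {k n} → (Fin k → Fin n) → DelSet k → DelSet n
mapDel f = map (⊎.map f (×.map f f))

module _ {k n} (f : Fin k → Fin n) (f-inj : ∀ {a b} → f a ≡ f b → a ≡ b) where

  vertexDeleted-map : ∀ F v → vertexDeleted (mapDel f F) (f v) ≡ vertexDeleted F v
  vertexDeleted-map []            v = refl
  vertexDeleted-map (inj₁ x ∷ F) v = cong₂ _∨_ (==-injective f f-inj x v) (vertexDeleted-map F v)
  vertexDeleted-map (inj₂ _ ∷ F) v = vertexDeleted-map F v

  edgeDeleted-map : ∀ F u v → edgeDeleted (mapDel f F) (f u) (f v) ≡ edgeDeleted F u v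
  edgeDeleted-map []                  u v = refl
  edgeDeleted-map (inj₁ _ ∷ F)       u v = edgeDeleted-map F u v
  edgeDeleted-map (inj₂ (a , b) ∷ F) u v
    rewrite ==-injective f f-inj a u | ==-injective f f-inj b v
          | ==-injective f f-inj a v | ==-injective f f-inj b u = cong (coversEdge (a , b) u v ∨_) (edgeDeleted-map F u v)

module _ {k n} {G : Graph k} {H : Graph n} (ι : G ≅ H) where
  open _≅_ ι

  private
    to-inj : ∀ {a b} → Inverse.to σ a ≡ Inverse.to σ b → a ≡ b
    to-inj = Injection.injective (↔⇒↣ σ)

  live-≅ : ∀ F u v → live H (mapDel (Inverse.to σ) F) (Inverse.to σ u) (Inverse.to σ v) ≡ live G F u v
  live-≅ F u v rewrite vertexDeleted-map _ to-inj F u | vertexDeleted-map _ to-inj F v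
                     | edgeDeleted-map _ to-inj F u v | pres u v = refl

  transport : ∀ {F} → FracPerfectMatching H (mapDel (Inverse.to σ) F) → FracPerfectMatching G F
  transport {F} M = record
    { weight        = λ u v → weight M (Inverse.to σ u) (Inverse.to σ v)
    ; weight-sym    = λ u v → weight-sym M _ _
    ; weight-nonNeg = λ u v → weight-nonNeg M _ _
    ; weight-dead   = λ u v dead → weight-dead M _ _ (trans (live-≅ F u v) dead)
    ; degree-one    = λ v kept → trans (sym (sum-permute (weight M (Inverse.to σ v)) σ))
                                       (degree-one M _ (trans (vertexDeleted-map _ to-inj F v) kept))
    }

coversEdge-sym : ∀ {n} (e : Fin n × Fin n) u v → coversEdge e u v ≡ coversEdge e v u
coversEdge-sym (a , b) u v = 𝔹.∨-comm (a == u ∧ b == v) (a == v ∧ b == u)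

coversEdge-fst : ∀ {n} (a b v : Fin n) → coversEdge (a , b) a v ≡ (b == v)
coversEdge-fst a b v with a ≟ v
... | yes refl rewrite ==-refl a = 𝔹.∨-idem (b == a)
... | no _     rewrite ==-refl a = 𝔹.∨-identityʳ (b == v)

coversEdge-snd : ∀ {n} (a b u : Fin n) → coversEdge (a , b) b u ≡ (a == u)
coversEdge-snd a b u with b ≟ u
... | yes refl rewrite ==-refl b =
  trans (cong₂ _∨_ (𝔹.∧-identityʳ (a == b)) (𝔹.∧-identityʳ (a == b))) (𝔹.∨-idem (a == b))
... | no _     rewrite ==-refl b = cong₂ _∨_ (𝔹.∧-zeroʳ (a == b)) (𝔹.∧-identityʳ (a == u))

coversEdge-away : ∀ {n} {a b u : Fin n} v → ¬ a ≡ u → ¬ b ≡ u → coversEdge (a , b) u v ≡ false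
coversEdge-away {a = a} v a≢u b≢u rewrite ≢⇒==-false a≢u | ≢⇒==-false b≢u = 𝔹.∧-zeroʳ (a == v)

edgeDeleted-sym : ∀ {n} (F : DelSet n) u v → edgeDeleted F u v ≡ edgeDeleted F v u
edgeDeleted-sym []            u v = refl
edgeDeleted-sym (inj₁ _ ∷ F) u v = edgeDeleted-sym F u v
edgeDeleted-sym (inj₂ e ∷ F) u v = cong₂ _∨_ (coversEdge-sym e u v) (edgeDeleted-sym F u v)

live-sym : ∀ {n} (G : Graph n) F u v → G u v ≡ G v u → live G F u v ≡ live G F v u
live-sym G F u v Guv≡Gvu rewrite Guv≡Gvu | edgeDeleted-sym F u v
  with G v u | vertexDeleted F u | vertexDeleted F v
... | false | _     | _     = refl
... | true  | true  | true  = refl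
... | true  | true  | false = refl
... | true  | false | true  = refl
... | true  | false | false = refl

vertexDeleted-redundant : ∀ {n} (K : DelSet n) d → vertexDeleted K d ≡ true →
  ∀ a → vertexDeleted (inj₁ d ∷ K) a ≡ vertexDeleted K a
vertexDeleted-redundant K d d∈K a with d ≟ a
... | yes refl = sym d∈K
... | no _     = refl

live-redundant : ∀ {n} (G : Graph n) (K : DelSet n) d → vertexDeleted K d ≡ true →
  ∀ a b → live G (inj₁ d ∷ K) a b ≡ live G K a b
live-redundant G K d d∈K a b =
  cong₂ (λ x y → G a b ∧ not x ∧ not y ∧ not (edgeDeleted K a b))
        (vertexDeleted-redundant K d d∈K a) (vertexDeleted-redundant K d d∈K b)

-- Robustness, and the base case G(8,4)

-- The induction hypothesis: fractional perfect matchings survive the deletion of any m − 2 elements, and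
-- of any two vertices (which for m = 3 is not an instance of the first clause).
record Robust (m : ℕ) {k} (G : Graph k) : Set where
  field
    irreflexive           : ∀ a → G a a ≡ false
    survives              : ∀ F → 2 + length F ≤ m → FracPerfectMatching G F
    survives-two-vertices : ∀ u v → FracPerfectMatching G (inj₁ u ∷ inj₁ v ∷ [])

open Robust

robust-≅ : ∀ {m k n} {G : Graph k} {H : Graph n} → G ≅ H → Robust m H → Robust m G
robust-≅ {m} ι R = record
  { irreflexive = λ a → trans (pres a a) (irreflexive R _)
  ; survives = λ F l → transport ι (survives R (mapDel (Inverse.to σ) F) (subst (λ k → 2 + k ≤ m) (sym (length-map _ F)) l))
  ; survives-two-vertices = λ u v → transport ι (survives-two-vertices R _ _)
  }
  where open _≅_ ι

allFin : ∀ n → (Fin n → Bool) → Bool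
allFin zero    p = true
allFin (suc n) p = p zero ∧ allFin n (λ i → p (suc i))

allFin-sound : ∀ n (p : Fin n → Bool) → allFin n p ≡ true → ∀ i → p i ≡ true
allFin-sound (suc n) p all-p i with p zero in p0
allFin-sound (suc n) p all-p zero    | true = p0
allFin-sound (suc n) p all-p (suc i) | true = allFin-sound n (λ i → p (suc i)) all-p i

allFin₂-sound : ∀ n (p : Fin n → Fin n → Bool) → allFin n (λ a → allFin n (p a)) ≡ true → ∀ a b → p a b ≡ true
allFin₂-sound n p all-p a = allFin-sound n (p a) (allFin-sound n (λ a → allFin n (p a)) all-p a)

sumℕ : ∀ n → (Fin n → ℕ) → ℕ
sumℕ zero    f = 0
sumℕ (suc n) f = f zero + sumℕ n (λ i → f (suc i))

fromℕ : ℕ → ℚ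
fromℕ zero    = 0ℚ
fromℕ (suc k) = 1ℚ +ℚ fromℕ k

fromℕ-+ : ∀ a b → fromℕ (a + b) ≡ fromℕ a +ℚ fromℕ b
fromℕ-+ zero    b = sym (ℚ.+-identityˡ (fromℕ b))
fromℕ-+ (suc a) b = trans (cong (1ℚ +ℚ_) (fromℕ-+ a b)) (sym (ℚ.+-assoc 1ℚ (fromℕ a) (fromℕ b)))

fromℕ-nonNeg : ∀ a → 0ℚ ≤ℚ fromℕ a
fromℕ-nonNeg zero    = ℚ.≤-refl
fromℕ-nonNeg (suc a) = ℚ.+-mono-≤ {0ℚ} {1ℚ} (ℚ.<⇒≤ (ℚ.positive⁻¹ 1ℚ)) (fromℕ-nonNeg a)

sum-fromℕ : ∀ n (f : Fin n → ℕ) → sum (λ i → fromℕ (f i)) ≡ fromℕ (sumℕ n f)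
sum-fromℕ zero    f = refl
sum-fromℕ (suc n) f = trans (cong (fromℕ (f zero) +ℚ_) (sum-fromℕ n (λ i → f (suc i)))) (sym (fromℕ-+ (f zero) _))

-- Doubled weights c certifying the half-integral fractional perfect matching c / 2.
certifies : ∀ {k} → Graph k → DelSet k → (Fin k → Fin k → ℕ) → Bool
certifies {k} G F c =
  allFin k (λ u → allFin k (λ v → (c u v ≡ᵇ c v u) ∧ (live G F u v ∨ (c u v ≡ᵇ 0))))
  ∧ allFin k (λ v → vertexDeleted F v ∨ (sumℕ k (c v) ≡ᵇ 2))

certified : ∀ {k} (G : Graph k) F c → certifies G F c ≡ true → FracPerfectMatching G F
certified {k} G F c ok = record
  { weight = λ u v → fromℕ (c u v) *ℚ ½
  ; weight-sym = λ u v → cong (λ x → fromℕ x *ℚ ½) (≡ᵇ⇒≡ (c u v) (c v u) (𝔹.∧-conicalˡ _ _ (edge-ok u v)))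
  ; weight-nonNeg = λ u v → *-nonNeg (fromℕ-nonNeg (c u v)) (ℚ.<⇒≤ (ℚ.positive⁻¹ ½))
  ; weight-dead = vanishes
  ; degree-one = degree-two
  }
  where
    edge-ok : ∀ u v → ((c u v ≡ᵇ c v u) ∧ (live G F u v ∨ (c u v ≡ᵇ 0))) ≡ true
    edge-ok = allFin₂-sound k _ (𝔹.∧-conicalˡ _ _ ok)

    ≡ᵇ⇒≡ : ∀ a b → (a ≡ᵇ b) ≡ true → a ≡ b
    ≡ᵇ⇒≡ a b eq = ℕ.≡ᵇ⇒≡ a b (subst T (sym eq) tt)

    vanishes : ∀ u v → live G F u v ≡ false → fromℕ (c u v) *ℚ ½ ≡ 0ℚ
    vanishes u v dead = trans (cong (λ x → fromℕ x *ℚ ½) (≡ᵇ⇒≡ (c u v) 0 c≡0)) (ℚ.*-zeroˡ ½)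
      where c≡0 = trans (cong (_∨ (c u v ≡ᵇ 0)) (sym dead)) (𝔹.∧-conicalʳ _ _ (edge-ok u v))

    degree-two : ∀ v → vertexDeleted F v ≡ false → sum (λ u → fromℕ (c v u) *ℚ ½) ≡ 1ℚ
    degree-two v kept = begin
      sum (λ u → fromℕ (c v u) *ℚ ½)  ≡⟨ sum-cong-≗ (λ u → ℚ.*-comm (fromℕ (c v u)) ½) ⟩
      sum (λ u → ½ *ℚ fromℕ (c v u))  ≡⟨ *-distribˡ-sum ½ (λ u → fromℕ (c v u)) ⟨
      ½ *ℚ sum (λ u → fromℕ (c v u))  ≡⟨ cong (½ *ℚ_) (sum-fromℕ k (c v)) ⟩
      ½ *ℚ fromℕ (sumℕ k (c v))       ≡⟨ cong (λ x → ½ *ℚ fromℕ x) (≡ᵇ⇒≡ (sumℕ k (c v)) 2 deg≡2) ⟩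
      1ℚ                              ∎
      where
        open ≡-Reasoning
        deg≡2 = trans (cong (_∨ (sumℕ k (c v) ≡ᵇ 2)) (sym kept)) (allFin-sound k _ (𝔹.∧-conicalʳ _ _ ok) v)

-- Doubled weights on the edges {i, j} of G(8,4), i, j < 8, each edge listed once.
Pattern : Set
Pattern = List (ℕ × ℕ × ℕ)

patternWeight : Pattern → ℕ → ℕ → ℕ
patternWeight []                  x y = 0
patternWeight ((i , j , w) ∷ P) x y =
  if ((i ≡ᵇ x) ∧ (j ≡ᵇ y)) ∨ ((i ≡ᵇ y) ∧ (j ≡ᵇ x)) then w else patternWeight P x y

-- The rotation i ↦ i + r of G(8,4) applied to a pattern.
rotate : ℕ → Pattern → Fin 8 → Fin 8 → ℕ
rotate r P x y = patternWeight P ((toℕ x + 8 ∸ r) % 8) ((toℕ y + 8 ∸ r) % 8)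

-- The three perfect matchings into which the edges of G(8,4) fall.
matching₁ matching₂ matching₃ : Pattern
matching₁ = (0 , 1 , 2) ∷ (2 , 3 , 2) ∷ (4 , 5 , 2) ∷ (6 , 7 , 2) ∷ []
matching₂ = (1 , 2 , 2) ∷ (3 , 4 , 2) ∷ (5 , 6 , 2) ∷ (7 , 0 , 2) ∷ []
matching₃ = (0 , 4 , 2) ∷ (1 , 5 , 2) ∷ (2 , 6 , 2) ∷ (3 , 7 , 2) ∷ []

without₀ : Pattern
without₀ = (1 , 2 , 1) ∷ (2 , 3 , 1) ∷ (3 , 4 , 1) ∷ (4 , 5 , 1) ∷ (5 , 1 , 1) ∷ (6 , 7 , 2) ∷ []

without₀and : ℕ → Pattern
without₀and 1 = (2 , 3 , 2) ∷ (4 , 5 , 2) ∷ (6 , 7 , 2) ∷ []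
without₀and 2 = (1 , 5 , 2) ∷ (3 , 4 , 2) ∷ (6 , 7 , 2) ∷ []
without₀and 3 = (1 , 2 , 2) ∷ (4 , 5 , 2) ∷ (6 , 7 , 2) ∷ []
without₀and 4 = (1 , 2 , 2) ∷ (3 , 7 , 2) ∷ (5 , 6 , 2) ∷ []
without₀and 5 = (1 , 2 , 2) ∷ (3 , 4 , 2) ∷ (6 , 7 , 2) ∷ []
without₀and 6 = (1 , 2 , 2) ∷ (3 , 7 , 2) ∷ (4 , 5 , 2) ∷ []
without₀and _ = (1 , 2 , 2) ∷ (3 , 4 , 2) ∷ (5 , 6 , 2) ∷ []

withoutVertex : Fin 8 → Fin 8 → Fin 8 → ℕ
withoutVertex v = rotate (toℕ v) without₀

withoutEdge : Fin 8 → Fin 8 → Fin 8 → Fin 8 → ℕ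
withoutEdge a b =
  if rotate 0 matching₁ a b ≡ᵇ 0 then rotate 0 matching₁
  else if rotate 0 matching₂ a b ≡ᵇ 0 then rotate 0 matching₂
  else rotate 0 matching₃

withoutVertices : Fin 8 → Fin 8 → Fin 8 → Fin 8 → ℕ
withoutVertices a b =
  if a == b then withoutVertex a else rotate (toℕ a) (without₀and ((toℕ b + 8 ∸ toℕ a) % 8))

robust-G84 : Robust 3 G84
robust-G84 = record
  { irreflexive = λ v → not-flip (allFin-sound 8 (λ v → not (G84 v v)) refl v)
  ; survives = survives-G84
  ; survives-two-vertices = λ a b →
      certified G84 _ (withoutVertices a b)
        (allFin₂-sound 8 (λ a b → certifies G84 (inj₁ a ∷ inj₁ b ∷ []) (withoutVertices a b)) refl a b)
  }
  where
    survives-G84 : ∀ F → 2 + length F ≤ 3 → FracPerfectMatching G84 F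
    survives-G84 []                  _ = certified G84 [] (rotate 0 matching₁) refl
    survives-G84 (inj₁ v ∷ [])       _ =
      certified G84 _ (withoutVertex v) (allFin-sound 8 (λ v → certifies G84 (inj₁ v ∷ []) (withoutVertex v)) refl v)
    survives-G84 (inj₂ (a , b) ∷ []) _ =
      certified G84 _ (withoutEdge a b) (allFin₂-sound 8 (λ a b → certifies G84 (inj₂ (a , b) ∷ []) (withoutEdge a b)) refl a b)
    survives-G84 (_ ∷ _ ∷ _) (s≤s (s≤s (s≤s ())))

-- Joins G0 ⊕φ G1

module Halves (n : ℕ) where

  L R : Fin n → Fin (n + n)
  L a = a ↑ˡ n
  R b = n ↑ʳ b

  data Side : Fin (n + n) → Set where
    isL : (a : Fin n) → Side (L a)
    isR : (b : Fin n) → Side (R b)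

  side : (x : Fin (n + n)) → Side x
  side x with splitAt n x in eq
  ... | inj₁ a = subst Side (Fin.splitAt⁻¹-↑ˡ eq) (isL a)
  ... | inj₂ b = subst Side (Fin.splitAt⁻¹-↑ʳ eq) (isR b)

  splitAt-L : (a : Fin n) → splitAt n (L a) ≡ inj₁ a
  splitAt-L a = Fin.splitAt-↑ˡ n a n

  splitAt-R : (b : Fin n) → splitAt n (R b) ≡ inj₂ b
  splitAt-R b = Fin.splitAt-↑ʳ n n b

  L≢R : (a b : Fin n) → ¬ L a ≡ R b
  L≢R a b eq with trans (sym (splitAt-L a)) (trans (cong (splitAt n) eq) (splitAt-R b))
  ... | ()

  L==L : (a b : Fin n) → (L a == L b) ≡ (a == b)
  L==L = ==-injective L (Fin.↑ˡ-injective n _ _)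

  R==R : (a b : Fin n) → (R a == R b) ≡ (a == b)
  R==R = ==-injective R (Fin.↑ʳ-injective n _ _)

  L==R : (a b : Fin n) → (L a == R b) ≡ false
  L==R a b = ≢⇒==-false (L≢R a b)

  R==L : (b a : Fin n) → (R b == L a) ≡ false
  R==L b a = ≢⇒==-false (L≢R a b ∘ sym)

  leftPart rightPart : DelSet (n + n) → DelSet n
  leftPart []                    = []
  leftPart (inj₁ x ∷ F)       with splitAt n x
  ... | inj₁ a = inj₁ a ∷ leftPart F
  ... | inj₂ _ = leftPart F
  leftPart (inj₂ (x , y) ∷ F) with splitAt n x | splitAt n y
  ... | inj₁ a | inj₁ b = inj₂ (a , b) ∷ leftPart F
  ... | inj₁ _ | inj₂ _ = leftPart F
  ... | inj₂ _ | inj₁ _ = leftPart F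
  ... | inj₂ _ | inj₂ _ = leftPart F

  rightPart []                    = []
  rightPart (inj₁ x ∷ F)       with splitAt n x
  ... | inj₁ _ = rightPart F
  ... | inj₂ b = inj₁ b ∷ rightPart F
  rightPart (inj₂ (x , y) ∷ F) with splitAt n x | splitAt n y
  ... | inj₁ _ | inj₁ _ = rightPart F
  ... | inj₁ _ | inj₂ _ = rightPart F
  ... | inj₂ _ | inj₁ _ = rightPart F
  ... | inj₂ a | inj₂ b = inj₂ (a , b) ∷ rightPart F

  -- The deleted edges between the two halves, each oriented from left to right.
  crossPart : DelSet (n + n) → List (Fin n × Fin n)
  crossPart []                    = []
  crossPart (inj₁ _ ∷ F)          = crossPart F
  crossPart (inj₂ (x , y) ∷ F) with splitAt n x | splitAt n y
  ... | inj₁ _ | inj₁ _ = crossPart F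
  ... | inj₁ a | inj₂ b = (a , b) ∷ crossPart F
  ... | inj₂ b | inj₁ a = (a , b) ∷ crossPart F
  ... | inj₂ _ | inj₂ _ = crossPart F

  crossDeleted : List (Fin n × Fin n) → Fin n → Fin n → Bool
  crossDeleted []             u v = false
  crossDeleted ((a , b) ∷ X) u v = (a == u ∧ b == v) ∨ crossDeleted X u v

  length-parts : (F : DelSet (n + n)) → length (leftPart F) + length (rightPart F) + length (crossPart F) ≡ length F
  length-parts [] = refl
  length-parts (inj₁ x ∷ F) with splitAt n x
  ... | inj₁ _ = cong suc (length-parts F)
  ... | inj₂ _ = trans (cong (_+ length (crossPart F)) (ℕ.+-suc (length (leftPart F)) _)) (cong suc (length-parts F))
  length-parts (inj₂ (x , y) ∷ F) with splitAt n x | splitAt n y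
  ... | inj₁ _ | inj₁ _ = cong suc (length-parts F)
  ... | inj₁ _ | inj₂ _ = trans (ℕ.+-suc (length (leftPart F) + length (rightPart F)) _) (cong suc (length-parts F))
  ... | inj₂ _ | inj₁ _ = trans (ℕ.+-suc (length (leftPart F) + length (rightPart F)) _) (cong suc (length-parts F))
  ... | inj₂ _ | inj₂ _ = trans (cong (_+ length (crossPart F)) (ℕ.+-suc (length (leftPart F)) _)) (cong suc (length-parts F))

  vertexDeleted-L : ∀ F a → vertexDeleted F (L a) ≡ vertexDeleted (leftPart F) a
  vertexDeleted-L [] a = refl
  vertexDeleted-L (inj₁ x ∷ F) a with side x
  ... | isL c rewrite splitAt-L c | L==L c a = cong ((c == a) ∨_) (vertexDeleted-L F a)
  ... | isR c rewrite splitAt-R c | R==L c a = vertexDeleted-L F a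
  vertexDeleted-L (inj₂ (x , y) ∷ F) a with splitAt n x | splitAt n y
  ... | inj₁ _ | inj₁ _ = vertexDeleted-L F a
  ... | inj₁ _ | inj₂ _ = vertexDeleted-L F a
  ... | inj₂ _ | inj₁ _ = vertexDeleted-L F a
  ... | inj₂ _ | inj₂ _ = vertexDeleted-L F a

  vertexDeleted-R : ∀ F b → vertexDeleted F (R b) ≡ vertexDeleted (rightPart F) b
  vertexDeleted-R [] b = refl
  vertexDeleted-R (inj₁ x ∷ F) b with side x
  ... | isL c rewrite splitAt-L c | L==R c b = vertexDeleted-R F b
  ... | isR c rewrite splitAt-R c | R==R c b = cong ((c == b) ∨_) (vertexDeleted-R F b)
  vertexDeleted-R (inj₂ (x , y) ∷ F) b with splitAt n x | splitAt n y
  ... | inj₁ _ | inj₁ _ = vertexDeleted-R F b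
  ... | inj₁ _ | inj₂ _ = vertexDeleted-R F b
  ... | inj₂ _ | inj₁ _ = vertexDeleted-R F b
  ... | inj₂ _ | inj₂ _ = vertexDeleted-R F b

  edgeDeleted-LL : ∀ F u v → edgeDeleted F (L u) (L v) ≡ edgeDeleted (leftPart F) u v
  edgeDeleted-LL [] u v = refl
  edgeDeleted-LL (inj₁ x ∷ F) u v with splitAt n x
  ... | inj₁ _ = edgeDeleted-LL F u v
  ... | inj₂ _ = edgeDeleted-LL F u v
  edgeDeleted-LL (inj₂ (x , y) ∷ F) u v with side x | side y
  ... | isL a | isL b rewrite splitAt-L a | splitAt-L b | L==L a u | L==L b v | L==L a v | L==L b u =
    cong (coversEdge (a , b) u v ∨_) (edgeDeleted-LL F u v)
  ... | isL a | isR b rewrite splitAt-L a | splitAt-R b | R==L b v | R==L b u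
                            | 𝔹.∧-zeroʳ (L a == L u) | 𝔹.∧-zeroʳ (L a == L v) = edgeDeleted-LL F u v
  ... | isR a | isL b rewrite splitAt-R a | splitAt-L b | R==L a u | R==L a v = edgeDeleted-LL F u v
  ... | isR a | isR b rewrite splitAt-R a | splitAt-R b | R==L a u | R==L a v = edgeDeleted-LL F u v

  edgeDeleted-RR : ∀ F u v → edgeDeleted F (R u) (R v) ≡ edgeDeleted (rightPart F) u v
  edgeDeleted-RR [] u v = refl
  edgeDeleted-RR (inj₁ x ∷ F) u v with splitAt n x
  ... | inj₁ _ = edgeDeleted-RR F u v
  ... | inj₂ _ = edgeDeleted-RR F u v
  edgeDeleted-RR (inj₂ (x , y) ∷ F) u v with side x | side y
  ... | isR a | isR b rewrite splitAt-R a | splitAt-R b | R==R a u | R==R b v | R==R a v | R==R b u =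
    cong (coversEdge (a , b) u v ∨_) (edgeDeleted-RR F u v)
  ... | isR a | isL b rewrite splitAt-R a | splitAt-L b | L==R b v | L==R b u
                            | 𝔹.∧-zeroʳ (R a == R u) | 𝔹.∧-zeroʳ (R a == R v) = edgeDeleted-RR F u v
  ... | isL a | isR b rewrite splitAt-L a | splitAt-R b | L==R a u | L==R a v = edgeDeleted-RR F u v
  ... | isL a | isL b rewrite splitAt-L a | splitAt-L b | L==R a u | L==R a v = edgeDeleted-RR F u v

  edgeDeleted-LR : ∀ F u v → edgeDeleted F (L u) (R v) ≡ crossDeleted (crossPart F) u v
  edgeDeleted-LR [] u v = refl
  edgeDeleted-LR (inj₁ x ∷ F) u v = edgeDeleted-LR F u v
  edgeDeleted-LR (inj₂ (x , y) ∷ F) u v with side x | side y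
  ... | isL a | isR b rewrite splitAt-L a | splitAt-R b | L==L a u | R==R b v | L==R a v
                            | 𝔹.∨-identityʳ (a == u ∧ b == v) = cong ((a == u ∧ b == v) ∨_) (edgeDeleted-LR F u v)
  ... | isR b | isL a rewrite splitAt-L a | splitAt-R b | L==L a u | R==R b v | R==L b u
                            | 𝔹.∧-comm (b == v) (a == u) = cong ((a == u ∧ b == v) ∨_) (edgeDeleted-LR F u v)
  ... | isL a | isL b rewrite splitAt-L a | splitAt-L b | L==R b v | L==R a v
                            | 𝔹.∧-zeroʳ (L a == L u) = edgeDeleted-LR F u v
  ... | isR a | isR b rewrite splitAt-R a | splitAt-R b | R==L a u | R==L b u
                            | 𝔹.∧-zeroʳ (R a == R v) = edgeDeleted-LR F u v

module Join {n} (G0 G1 : Graph n) (φ : Fin n ↔ Fin n) where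

  open Halves n public

  H : Graph (n + n)
  H = G0 ⊕[ φ ] G1

  φ⁺ φ⁻ : Fin n → Fin n
  φ⁺ = Inverse.to φ
  φ⁻ = Inverse.from φ

  H-LL : ∀ a b → H (L a) (L b) ≡ G0 a b
  H-LL a b rewrite splitAt-L a | splitAt-L b = refl

  H-RR : ∀ a b → H (R a) (R b) ≡ G1 a b
  H-RR a b rewrite splitAt-R a | splitAt-R b = refl

  H-LR : ∀ a b → H (L a) (R b) ≡ (φ⁺ a == b)
  H-LR a b rewrite splitAt-L a | splitAt-R b = refl

  H-RL : ∀ b a → H (R b) (L a) ≡ (φ⁺ a == b)
  H-RL b a rewrite splitAt-L a | splitAt-R b = refl

  φ⁺==≡φ⁻== : ∀ a b → (φ⁺ a == b) ≡ (φ⁻ b == a)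
  φ⁺==≡φ⁻== a b = begin
    φ⁺ a == b         ≡⟨ cong (φ⁺ a ==_) (Inverse.strictlyInverseˡ φ b) ⟨
    φ⁺ a == φ⁺ (φ⁻ b) ≡⟨ ==-injective φ⁺ (Injection.injective (↔⇒↣ φ)) a (φ⁻ b) ⟩
    a == φ⁻ b         ≡⟨ ==-sym a (φ⁻ b) ⟩
    φ⁻ b == a         ∎
    where open ≡-Reasoning

  record Gluing (F : DelSet (n + n)) : Set where
    field
      left right    : Fin n → Fin n → ℚ
      rung          : Fin n → ℚ
      left-sym      : ∀ a b → left a b ≡ left b a
      right-sym     : ∀ a b → right a b ≡ right b a
      left-nonNeg   : ∀ a b → 0ℚ ≤ℚ left a b
      right-nonNeg  : ∀ a b → 0ℚ ≤ℚ right a b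
      rung-nonNeg   : ∀ a → 0ℚ ≤ℚ rung a
      left-dead     : ∀ a b → live H F (L a) (L b) ≡ false → left a b ≡ 0ℚ
      right-dead    : ∀ a b → live H F (R a) (R b) ≡ false → right a b ≡ 0ℚ
      rung-dead     : ∀ a → live H F (L a) (R (φ⁺ a)) ≡ false → rung a ≡ 0ℚ
      left-degree   : ∀ a → vertexDeleted F (L a) ≡ false → sum (left a) +ℚ rung a ≡ 1ℚ
      right-degree  : ∀ b → vertexDeleted F (R b) ≡ false → sum (right b) +ℚ rung (φ⁻ b) ≡ 1ℚ

    rungAt : Fin n → Fin n → ℚ
    rungAt a b = if φ⁺ a == b then rung a else 0ℚ

    joined : Fin (n + n) → Fin (n + n) → ℚ
    joined x y with splitAt n x | splitAt n y
    ... | inj₁ a | inj₁ b = left a b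
    ... | inj₂ a | inj₂ b = right a b
    ... | inj₁ a | inj₂ b = rungAt a b
    ... | inj₂ b | inj₁ a = rungAt a b

    joined-LL : ∀ a b → joined (L a) (L b) ≡ left a b
    joined-LL a b rewrite splitAt-L a | splitAt-L b = refl

    joined-RR : ∀ a b → joined (R a) (R b) ≡ right a b
    joined-RR a b rewrite splitAt-R a | splitAt-R b = refl

    joined-LR : ∀ a b → joined (L a) (R b) ≡ rungAt a b
    joined-LR a b rewrite splitAt-L a | splitAt-R b = refl

    joined-RL : ∀ b a → joined (R b) (L a) ≡ rungAt a b
    joined-RL b a rewrite splitAt-L a | splitAt-R b = refl

    rungAt-nonNeg : ∀ a b → 0ℚ ≤ℚ rungAt a b
    rungAt-nonNeg a b with φ⁺ a == b
    ... | true  = rung-nonNeg a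
    ... | false = ℚ.≤-refl

    rungAt-dead : ∀ a b → live H F (L a) (R b) ≡ false → rungAt a b ≡ 0ℚ
    rungAt-dead a b dead with φ⁺ a ≟ b
    ... | yes refl = rung-dead a dead
    ... | no _     = refl

    joined-sym : ∀ x y → joined x y ≡ joined y x
    joined-sym x y with side x | side y
    ... | isL a | isL b rewrite joined-LL a b | joined-LL b a = left-sym a b
    ... | isR a | isR b rewrite joined-RR a b | joined-RR b a = right-sym a b
    ... | isL a | isR b rewrite joined-LR a b | joined-RL b a = refl
    ... | isR b | isL a rewrite joined-LR a b | joined-RL b a = refl

    joined-nonNeg : ∀ x y → 0ℚ ≤ℚ joined x y
    joined-nonNeg x y with side x | side y
    ... | isL a | isL b rewrite joined-LL a b = left-nonNeg a b
    ... | isR a | isR b rewrite joined-RR a b = right-nonNeg a b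
    ... | isL a | isR b rewrite joined-LR a b = rungAt-nonNeg a b
    ... | isR b | isL a rewrite joined-RL b a = rungAt-nonNeg a b

    joined-dead : ∀ x y → live H F x y ≡ false → joined x y ≡ 0ℚ
    joined-dead x y dead with side x | side y
    ... | isL a | isL b rewrite joined-LL a b = left-dead a b dead
    ... | isR a | isR b rewrite joined-RR a b = right-dead a b dead
    ... | isL a | isR b rewrite joined-LR a b = rungAt-dead a b dead
    ... | isR b | isL a rewrite joined-RL b a =
      rungAt-dead a b (trans (live-sym H F (L a) (R b) (trans (H-LR a b) (sym (H-RL b a)))) dead)

    joined-degree : ∀ x → vertexDeleted F x ≡ false → sum (joined x) ≡ 1ℚ
    joined-degree x kept with side x
    ... | isL a = begin
      sum (joined (L a))                                           ≡⟨ sum-↑ n {n} (joined (L a)) ⟩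
      sum (λ b → joined (L a) (L b)) +ℚ sum (λ b → joined (L a) (R b))
                                 ≡⟨ cong₂ _+ℚ_ (sum-cong-≗ (joined-LL a)) (sum-cong-≗ (joined-LR a)) ⟩
      sum (left a) +ℚ sum (rungAt a)  ≡⟨ cong (sum (left a) +ℚ_) (sum-indicator (φ⁺ a) (λ _ → rung a)) ⟩
      sum (left a) +ℚ rung a          ≡⟨ left-degree a kept ⟩
      1ℚ                              ∎
      where open ≡-Reasoning
    ... | isR b = begin
      sum (joined (R b))                                           ≡⟨ sum-↑ n {n} (joined (R b)) ⟩
      sum (λ a → joined (R b) (L a)) +ℚ sum (λ c → joined (R b) (R c))
                                 ≡⟨ cong₂ _+ℚ_ (sum-cong-≗ rung-column) (sum-cong-≗ (joined-RR b)) ⟩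
      sum (λ a → if φ⁻ b == a then rung a else 0ℚ) +ℚ sum (right b)
                                 ≡⟨ cong (_+ℚ sum (right b)) (sum-indicator (φ⁻ b) rung) ⟩
      rung (φ⁻ b) +ℚ sum (right b)    ≡⟨ ℚ.+-comm (rung (φ⁻ b)) (sum (right b)) ⟩
      sum (right b) +ℚ rung (φ⁻ b)    ≡⟨ right-degree b kept ⟩
      1ℚ                              ∎
      where
        open ≡-Reasoning
        rung-column : ∀ a → joined (R b) (L a) ≡ (if φ⁻ b == a then rung a else 0ℚ)
        rung-column a = trans (joined-RL b a) (cong (if_then rung a else 0ℚ) (φ⁺==≡φ⁻== a b))

  glue : ∀ {F} → Gluing F → FracPerfectMatching H F
  glue Γ = record
    { weight = joined ; weight-sym = joined-sym ; weight-nonNeg = joined-nonNeg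
    ; weight-dead = joined-dead ; degree-one = joined-degree }
    where open Gluing Γ

  live-LL : ∀ F a b → live H F (L a) (L b) ≡ live G0 (leftPart F) a b
  live-LL F a b rewrite H-LL a b | vertexDeleted-L F a | vertexDeleted-L F b | edgeDeleted-LL F a b = refl

  live-RR : ∀ F a b → live H F (R a) (R b) ≡ live G1 (rightPart F) a b
  live-RR F a b rewrite H-RR a b | vertexDeleted-R F a | vertexDeleted-R F b | edgeDeleted-RR F a b = refl

  gluingDisjoint : ∀ {F K₀ K₁} →
    (∀ a → vertexDeleted F (L a) ≡ vertexDeleted K₀ a) → (∀ b → vertexDeleted F (R b) ≡ vertexDeleted K₁ b) →
    (∀ a b → live H F (L a) (L b) ≡ live G0 K₀ a b) → (∀ a b → live H F (R a) (R b) ≡ live G1 K₁ a b) →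
    FracPerfectMatching G0 K₀ → FracPerfectMatching G1 K₁ → Gluing F
  gluingDisjoint vertex-L vertex-R live-L live-R M₀ M₁ = record
    { left = weight M₀ ; right = weight M₁ ; rung = λ _ → 0ℚ
    ; left-sym = weight-sym M₀ ; right-sym = weight-sym M₁
    ; left-nonNeg = weight-nonNeg M₀ ; right-nonNeg = weight-nonNeg M₁ ; rung-nonNeg = λ _ → ℚ.≤-refl
    ; left-dead = λ a b dead → weight-dead M₀ a b (trans (sym (live-L a b)) dead)
    ; right-dead = λ a b dead → weight-dead M₁ a b (trans (sym (live-R a b)) dead)
    ; rung-dead = λ _ _ → refl
    ; left-degree = λ a kept → trans (ℚ.+-identityʳ _) (degree-one M₀ a (trans (sym (vertex-L a)) kept))
    ; right-degree = λ b kept → trans (ℚ.+-identityʳ _) (degree-one M₁ b (trans (sym (vertex-R b)) kept))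
    }

  record OnLeftCopy (F : DelSet (n + n)) (K : DelSet n) : Set where
    field
      vertex-L : ∀ a → vertexDeleted F (L a) ≡ vertexDeleted K a
      edge-LL  : ∀ a b → edgeDeleted F (L a) (L b) ≡ edgeDeleted K a b
      vertex-R : ∀ b → vertexDeleted F (R b) ≡ false
      edge-RR  : ∀ a b → edgeDeleted F (R a) (R b) ≡ false
      edge-LR  : ∀ a b → edgeDeleted F (L a) (R b) ≡ false

    live-left : ∀ a b → live H F (L a) (L b) ≡ live G0 K a b
    live-left a b rewrite H-LL a b | vertex-L a | vertex-L b | edge-LL a b = refl

    live-right : ∀ a b → live H F (R a) (R b) ≡ G1 a b
    live-right a b rewrite H-RR a b | vertex-R a | vertex-R b | edge-RR a b = 𝔹.∧-identityʳ (G1 a b)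

    live-rung : ∀ a → live H F (L a) (R (φ⁺ a)) ≡ not (vertexDeleted K a)
    live-rung a rewrite H-LR a (φ⁺ a) | ==-refl (φ⁺ a) | vertex-L a | vertex-R (φ⁺ a) | edge-LR a (φ⁺ a) =
      𝔹.∧-identityʳ _

  gluingVertexRedundant : ∀ {F K} d → OnLeftCopy F (inj₁ d ∷ K) → vertexDeleted K d ≡ true →
    FracPerfectMatching G0 K → FracPerfectMatching G1 [] → Gluing F
  gluingVertexRedundant {F} {K} d onLeft d∈K =
    gluingDisjoint (λ a → trans (vertex-L a) (vertexDeleted-redundant K d d∈K a)) vertex-R
                   (λ a b → trans (live-left a b) (live-redundant G0 K d d∈K a b))
                   (λ a b → trans (live-right a b) (sym (𝔹.∧-identityʳ (G1 a b))))
    where open OnLeftCopy onLeft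

  -- The weight f a d that a sent to the deleted vertex d now goes along the rung a φ⁺ a; the right copy
  -- absorbs it by superposing, for every a, a fractional perfect matching of G1 − φ⁺ a scaled by f a d.
  module VertexDeletion {F K} (d : Fin n) (onLeft : OnLeftCopy F (inj₁ d ∷ K)) (d∉K : vertexDeleted K d ≡ false)
                        (G0-irrefl : ∀ a → G0 a a ≡ false) (f : FracPerfectMatching G0 K)
                        (g : ∀ u → FracPerfectMatching G1 (inj₁ u ∷ [])) where
    open OnLeftCopy onLeft
    open ≡-Reasoning

    rung : Fin n → ℚ
    rung a = weight f a d

    left right : Fin n → Fin n → ℚ
    left a b = if (d == a) ∨ (d == b) then 0ℚ else weight f a b
    right y z = sum (λ u → rung u *ℚ weight (g (φ⁺ u)) y z)

    left-sym : ∀ a b → left a b ≡ left b a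
    left-sym a b rewrite 𝔹.∨-comm (d == a) (d == b) | weight-sym f a b = refl

    right-sym : ∀ a b → right a b ≡ right b a
    right-sym a b = sum-cong-≗ (λ u → cong (rung u *ℚ_) (weight-sym (g (φ⁺ u)) a b))

    left-dead : ∀ a b → live G0 (inj₁ d ∷ K) a b ≡ false → left a b ≡ 0ℚ
    left-dead a b dead with d == a | d == b
    ... | true  | _     = refl
    ... | false | true  = refl
    ... | false | false = weight-dead f a b dead

    right-dead : ∀ a b → G1 a b ≡ false → right a b ≡ 0ℚ
    right-dead a b no-edge = sum-zero {n} λ u →
      trans (cong (rung u *ℚ_) (weight-dead (g (φ⁺ u)) a b (live-nonEdge G1 (inj₁ (φ⁺ u) ∷ []) a b no-edge)))
            (ℚ.*-zeroʳ (rung u))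

    rung-dead : ∀ a → not ((d == a) ∨ vertexDeleted K a) ≡ false → rung a ≡ 0ℚ
    rung-dead a dead with d ≟ a
    ... | yes refl = weight-dead f d d (live-nonEdge G0 K d d (G0-irrefl d))
    ... | no _     = weight-dead f a d (live-deletedˡ G0 K a d (not-flip dead))

    left-degree : ∀ a → vertexDeleted F (L a) ≡ false → sum (left a) +ℚ rung a ≡ 1ℚ
    left-degree a kept = begin
      sum (left a) +ℚ rung a
        ≡⟨ cong (_+ℚ rung a) (sum-cong-≗ left-row) ⟩
      sum (λ b → if d == b then 0ℚ else weight f a b) +ℚ weight f a d
        ≡⟨ sum-remove d (weight f a) ⟨
      sum (weight f a)  ≡⟨ degree-one f a (𝔹.∨-conicalʳ (d == a) _ a-kept) ⟩
      1ℚ                ∎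
      where
        a-kept = trans (sym (vertex-L a)) kept
        left-row : ∀ b → left a b ≡ (if d == b then 0ℚ else weight f a b)
        left-row b rewrite 𝔹.∨-conicalˡ (d == a) _ a-kept = refl

    absorbed : ∀ b u → rung u *ℚ sum (weight (g (φ⁺ u)) b) ≡ (if φ⁻ b == u then 0ℚ else rung u)
    absorbed b u rewrite sym (φ⁺==≡φ⁻== u b) with φ⁺ u == b in b≡φu
    ... | true  = trans (cong (rung u *ℚ_) (degree-zero (g (φ⁺ u)) b (cong (_∨ false) b≡φu))) (ℚ.*-zeroʳ (rung u))
    ... | false = trans (cong (rung u *ℚ_) (degree-one (g (φ⁺ u)) b (cong (_∨ false) b≡φu))) (ℚ.*-identityʳ (rung u))

    right-degree : ∀ b → vertexDeleted F (R b) ≡ false → sum (right b) +ℚ rung (φ⁻ b) ≡ 1ℚ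
    right-degree b _ = begin
      sum (right b) +ℚ rung (φ⁻ b)
        ≡⟨ cong (_+ℚ rung (φ⁻ b)) (∑-comm (λ z u → rung u *ℚ weight (g (φ⁺ u)) b z)) ⟩
      sum (λ u → sum (λ z → rung u *ℚ weight (g (φ⁺ u)) b z)) +ℚ rung (φ⁻ b)
        ≡⟨ cong (_+ℚ rung (φ⁻ b))
                (sum-cong-≗ (λ u → trans (sym (*-distribˡ-sum (rung u) (weight (g (φ⁺ u)) b))) (absorbed b u))) ⟩
      sum (λ u → if φ⁻ b == u then 0ℚ else rung u) +ℚ rung (φ⁻ b)
        ≡⟨ sum-remove (φ⁻ b) rung ⟨
      sum rung                      ≡⟨ sum-cong-≗ (λ u → weight-sym f u d) ⟩
      sum (weight f d)              ≡⟨ degree-one f d d∉K ⟩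
      1ℚ                            ∎

    gluing : Gluing F
    gluing = record
      { left = left ; right = right ; rung = rung
      ; left-sym = left-sym ; right-sym = right-sym
      ; left-nonNeg = λ a b → if-0-nonNeg ((d == a) ∨ (d == b)) (weight-nonNeg f a b)
      ; right-nonNeg = λ a b → sum-nonNeg {f = λ u → rung u *ℚ weight (g (φ⁺ u)) a b}
                                          (λ u → *-nonNeg (weight-nonNeg f u d) (weight-nonNeg (g (φ⁺ u)) a b))
      ; rung-nonNeg = λ a → weight-nonNeg f a d
      ; left-dead = λ a b dead → left-dead a b (trans (sym (live-left a b)) dead)
      ; right-dead = λ a b dead → right-dead a b (trans (sym (live-right a b)) dead)
      ; rung-dead = λ a dead → rung-dead a (trans (sym (live-rung a)) dead)
      ; left-degree = left-degree ; right-degree = right-degree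
      }

  -- Deleting the edge a0 b0 frees its weight t = f a0 b0 at both ends; it is sent along the rungs at a0 and b0,
  -- and the right copy mixes a fractional perfect matching of G1 with one of G1 − {φ⁺ a0, φ⁺ b0} in ratio 1 − t : t.
  module EdgeDeletion {F K} (a0 b0 : Fin n) (onLeft : OnLeftCopy F (inj₂ (a0 , b0) ∷ K))
                      (f : FracPerfectMatching G0 K) (g : FracPerfectMatching G1 [])
                      (h : FracPerfectMatching G1 (inj₁ (φ⁺ a0) ∷ inj₁ (φ⁺ b0) ∷ [])) where
    open OnLeftCopy onLeft
    open ≡-Reasoning

    t : ℚ
    t = weight f a0 b0

    endpoint : Fin n → Bool
    endpoint a = (a0 == a) ∨ (b0 == a)

    rung : Fin n → ℚ
    rung a = if endpoint a then t else 0ℚ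

    left right : Fin n → Fin n → ℚ
    left a b = if coversEdge (a0 , b0) a b then 0ℚ else weight f a b
    right y z = (1ℚ -ℚ t) *ℚ weight g y z +ℚ t *ℚ weight h y z

    t≤1 : t ≤ℚ 1ℚ
    t≤1 with vertexDeleted K a0 in a0∈K
    ... | false = subst (t ≤ℚ_) (degree-one f a0 a0∈K) (≤-sum (weight-nonNeg f a0) b0)
    ... | true  = subst (_≤ℚ 1ℚ) (sym (weight-dead f a0 b0 (live-deletedˡ G0 K a0 b0 a0∈K))) (ℚ.<⇒≤ (ℚ.positive⁻¹ 1ℚ))

    rung-nonNeg : ∀ a → 0ℚ ≤ℚ rung a
    rung-nonNeg a with endpoint a
    ... | true  = weight-nonNeg f a0 b0
    ... | false = ℚ.≤-refl

    left-sym : ∀ a b → left a b ≡ left b a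
    left-sym a b rewrite coversEdge-sym (a0 , b0) a b | weight-sym f a b = refl

    right-sym : ∀ a b → right a b ≡ right b a
    right-sym a b rewrite weight-sym g a b | weight-sym h a b = refl

    left-dead : ∀ a b → live G0 (inj₂ (a0 , b0) ∷ K) a b ≡ false → left a b ≡ 0ℚ
    left-dead a b dead with coversEdge (a0 , b0) a b
    ... | true  = refl
    ... | false = weight-dead f a b dead

    right-dead : ∀ a b → G1 a b ≡ false → right a b ≡ 0ℚ
    right-dead a b no-edge
      rewrite weight-dead g a b (live-nonEdge G1 [] a b no-edge)
            | weight-dead h a b (live-nonEdge G1 (inj₁ (φ⁺ a0) ∷ inj₁ (φ⁺ b0) ∷ []) a b no-edge)
            | ℚ.*-zeroʳ (1ℚ -ℚ t) | ℚ.*-zeroʳ t = refl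

    rung-dead : ∀ a → vertexDeleted K a ≡ true → rung a ≡ 0ℚ
    rung-dead a a∈K with a0 ≟ a | b0 ≟ a
    ... | yes refl | _        = weight-dead f a0 b0 (live-deletedˡ G0 K a0 b0 a∈K)
    ... | no _     | yes refl = weight-dead f a0 b0 (live-deletedʳ G0 K a0 b0 a∈K)
    ... | no _     | no _     = refl

    left-degree-a0 : vertexDeleted K a0 ≡ false → sum (left a0) +ℚ rung a0 ≡ 1ℚ
    left-degree-a0 a0∉K = begin
      sum (left a0) +ℚ rung a0
        ≡⟨ cong₂ _+ℚ_ (sum-cong-≗ (λ b → cong (if_then 0ℚ else weight f a0 b) (coversEdge-fst a0 b0 b)))
                      (cong (if_then t else 0ℚ) (cong (_∨ (b0 == a0)) (==-refl a0))) ⟩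
      sum (λ b → if b0 == b then 0ℚ else weight f a0 b) +ℚ weight f a0 b0
        ≡⟨ sum-remove b0 (weight f a0) ⟨
      sum (weight f a0)  ≡⟨ degree-one f a0 a0∉K ⟩
      1ℚ                 ∎

    left-degree-b0 : vertexDeleted K b0 ≡ false → sum (left b0) +ℚ rung b0 ≡ 1ℚ
    left-degree-b0 b0∉K = begin
      sum (left b0) +ℚ rung b0
        ≡⟨ cong₂ _+ℚ_ (sum-cong-≗ (λ b → cong (if_then 0ℚ else weight f b0 b) (coversEdge-snd a0 b0 b)))
                      (trans (cong (if_then t else 0ℚ) (trans (cong ((a0 == b0) ∨_) (==-refl b0)) (𝔹.∨-zeroʳ _)))
                             (weight-sym f a0 b0)) ⟩
      sum (λ b → if a0 == b then 0ℚ else weight f b0 b) +ℚ weight f b0 a0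
        ≡⟨ sum-remove a0 (weight f b0) ⟨
      sum (weight f b0)  ≡⟨ degree-one f b0 b0∉K ⟩
      1ℚ                 ∎

    left-degree-away : ∀ a → ¬ a0 ≡ a → ¬ b0 ≡ a → vertexDeleted K a ≡ false → sum (left a) +ℚ rung a ≡ 1ℚ
    left-degree-away a a0≢a b0≢a a∉K = begin
      sum (left a) +ℚ rung a
        ≡⟨ cong₂ _+ℚ_ (sum-cong-≗ (λ b → cong (if_then 0ℚ else weight f a b) (coversEdge-away b a0≢a b0≢a)))
                      (cong (if_then t else 0ℚ) (cong₂ _∨_ (≢⇒==-false a0≢a) (≢⇒==-false b0≢a))) ⟩
      sum (weight f a) +ℚ 0ℚ  ≡⟨ ℚ.+-identityʳ _ ⟩
      sum (weight f a)        ≡⟨ degree-one f a a∉K ⟩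
      1ℚ                      ∎

    left-degree : ∀ a → vertexDeleted K a ≡ false → sum (left a) +ℚ rung a ≡ 1ℚ
    left-degree a = by-cases (a0 ≟ a) (b0 ≟ a)
      where
        by-cases : Dec (a0 ≡ a) → Dec (b0 ≡ a) → vertexDeleted K a ≡ false → sum (left a) +ℚ rung a ≡ 1ℚ
        by-cases (yes refl) _          = left-degree-a0
        by-cases (no _)     (yes refl) = left-degree-b0
        by-cases (no a0≢a)  (no b0≢a)  = left-degree-away a a0≢a b0≢a

    rung-ends : ∀ b → vertexDeleted (inj₁ (φ⁺ a0) ∷ inj₁ (φ⁺ b0) ∷ []) b ≡ endpoint (φ⁻ b)
    rung-ends b = begin
      (φ⁺ a0 == b) ∨ (φ⁺ b0 == b) ∨ false  ≡⟨ cong ((φ⁺ a0 == b) ∨_) (𝔹.∨-identityʳ (φ⁺ b0 == b)) ⟩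
      (φ⁺ a0 == b) ∨ (φ⁺ b0 == b)          ≡⟨ cong₂ _∨_ (φ⁺==≡φ⁻== a0 b) (φ⁺==≡φ⁻== b0 b) ⟩
      (φ⁻ b == a0) ∨ (φ⁻ b == b0)          ≡⟨ cong₂ _∨_ (==-sym (φ⁻ b) a0) (==-sym (φ⁻ b) b0) ⟩
      endpoint (φ⁻ b)                       ∎

    right-degree : ∀ b → sum (right b) +ℚ rung (φ⁻ b) ≡ 1ℚ
    right-degree b = begin
      sum (right b) +ℚ rung (φ⁻ b)
        ≡⟨ cong (_+ℚ rung (φ⁻ b)) (∑-distrib-+ (λ z → (1ℚ -ℚ t) *ℚ weight g b z) (λ z → t *ℚ weight h b z)) ⟩
      sum (λ z → (1ℚ -ℚ t) *ℚ weight g b z) +ℚ sum (λ z → t *ℚ weight h b z) +ℚ rung (φ⁻ b)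
        ≡⟨ cong (λ x → x +ℚ rung (φ⁻ b)) (sym (cong₂ _+ℚ_ (*-distribˡ-sum (1ℚ -ℚ t) (weight g b))
                                                         (*-distribˡ-sum t (weight h b)))) ⟩
      (1ℚ -ℚ t) *ℚ sum (weight g b) +ℚ t *ℚ sum (weight h b) +ℚ rung (φ⁻ b)
        ≡⟨ cong (λ x → (1ℚ -ℚ t) *ℚ x +ℚ t *ℚ sum (weight h b) +ℚ rung (φ⁻ b)) (degree-one g b refl) ⟩
      (1ℚ -ℚ t) *ℚ 1ℚ +ℚ t *ℚ sum (weight h b) +ℚ rung (φ⁻ b)
        ≡⟨ balance ⟩
      1ℚ ∎
      where
        balance : (1ℚ -ℚ t) *ℚ 1ℚ +ℚ t *ℚ sum (weight h b) +ℚ rung (φ⁻ b) ≡ 1ℚ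
        balance with endpoint (φ⁻ b) in b-end
        ... | true  rewrite degree-zero h b (trans (rung-ends b) b-end) =
          solve 1 (λ t → (con 1ℚ :- t) :* con 1ℚ :+ t :* con 0ℚ :+ t := con 1ℚ) refl t
        ... | false rewrite degree-one h b (trans (rung-ends b) b-end) =
          solve 1 (λ t → (con 1ℚ :- t) :* con 1ℚ :+ t :* con 1ℚ :+ con 0ℚ := con 1ℚ) refl t

    gluing : Gluing F
    gluing = record
      { left = left ; right = right ; rung = rung
      ; left-sym = left-sym ; right-sym = right-sym
      ; left-nonNeg = λ a b → if-0-nonNeg (coversEdge (a0 , b0) a b) (weight-nonNeg f a b)
      ; right-nonNeg = λ a b → ℚ.+-mono-≤ (*-nonNeg (p≤q⇒0≤q-p t≤1) (weight-nonNeg g a b))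
                                            (*-nonNeg (weight-nonNeg f a0 b0) (weight-nonNeg h a b))
      ; rung-nonNeg = λ a → rung-nonNeg a
      ; left-dead = λ a b dead → left-dead a b (trans (sym (live-left a b)) dead)
      ; right-dead = λ a b dead → right-dead a b (trans (sym (live-right a b)) dead)
      ; rung-dead = λ a dead → rung-dead a (not-flip (trans (sym (live-rung a)) dead))
      ; left-degree = λ a kept → left-degree a (trans (sym (vertex-L a)) kept)
      ; right-degree = λ b _ → right-degree b
      }

  gluingOnLeft : ∀ {F} x K → OnLeftCopy F (x ∷ K) → (∀ a → G0 a a ≡ false) → FracPerfectMatching G0 K →
    FracPerfectMatching G1 [] → (∀ u → FracPerfectMatching G1 (inj₁ u ∷ [])) →
    (∀ u v → FracPerfectMatching G1 (inj₁ u ∷ inj₁ v ∷ [])) → Gluing F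
  gluingOnLeft (inj₁ d) K onLeft G0-irrefl f g g-u g-uv with vertexDeleted K d in d∈K
  ... | true  = gluingVertexRedundant d onLeft d∈K f g
  ... | false = VertexDeletion.gluing d onLeft d∈K G0-irrefl f g-u
  gluingOnLeft (inj₂ (a0 , b0)) K onLeft G0-irrefl f g g-u g-uv = EdgeDeletion.gluing a0 b0 onLeft f g (g-uv (φ⁺ a0) (φ⁺ b0))

  onLeftCopy-parts : ∀ {F} → rightPart F ≡ [] → crossPart F ≡ [] → OnLeftCopy F (leftPart F)
  onLeftCopy-parts {F} right≡[] cross≡[] = record
    { vertex-L = vertexDeleted-L F
    ; edge-LL  = edgeDeleted-LL F
    ; vertex-R = λ b → trans (vertexDeleted-R F b) (cong (λ K → vertexDeleted K b) right≡[])
    ; edge-RR  = λ a b → trans (edgeDeleted-RR F a b) (cong (λ K → edgeDeleted K a b) right≡[])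
    ; edge-LR  = λ a b → trans (edgeDeleted-LR F a b) (cong (λ X → crossDeleted X a b) cross≡[])
    }

-- G0 ⊕φ G1 ≅ G1 ⊕φ⁻¹ G0, so a deletion set concentrated on the right copy can be treated as one on the left.
module Swap {n} (G0 G1 : Graph n) (φ : Fin n ↔ Fin n) where
  open Join G0 G1 φ
  module J′ = Join G1 G0 (↔-sym φ)

  swap : Fin (n + n) → Fin (n + n)
  swap x with splitAt n x
  ... | inj₁ a = R a
  ... | inj₂ b = L b

  swap-L : ∀ a → swap (L a) ≡ R a
  swap-L a rewrite splitAt-L a = refl

  swap-R : ∀ b → swap (R b) ≡ L b
  swap-R b rewrite splitAt-R b = refl

  swap-involutive : ∀ x → swap (swap x) ≡ x
  swap-involutive x with side x
  ... | isL a rewrite swap-L a = swap-R a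
  ... | isR b rewrite swap-R b = swap-L b

  swap-injective : ∀ {x y} → swap x ≡ swap y → x ≡ y
  swap-injective {x} {y} eq = trans (sym (swap-involutive x)) (trans (cong swap eq) (swap-involutive y))

  swap-≅ : H ≅ J′.H
  swap-≅ = record { σ = mk↔ₛ′ swap swap swap-involutive swap-involutive ; pres = pres }
    where
      pres : ∀ x y → H x y ≡ J′.H (swap x) (swap y)
      pres x y with side x | side y
      ... | isL a | isL b rewrite swap-L a | swap-L b | H-LL a b | J′.H-RR a b = refl
      ... | isR a | isR b rewrite swap-R a | swap-R b | H-RR a b | J′.H-LL a b = refl
      ... | isL a | isR b rewrite swap-L a | swap-R b | H-LR a b | J′.H-RL a b = φ⁺==≡φ⁻== a b
      ... | isR b | isL a rewrite swap-L a | swap-R b | H-RL b a | J′.H-LR b a = φ⁺==≡φ⁻== a b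

  onLeftCopy-swapped : ∀ {F} → leftPart F ≡ [] → crossPart F ≡ [] → J′.OnLeftCopy (mapDel swap F) (rightPart F)
  onLeftCopy-swapped {F} left≡[] cross≡[] = record
    { vertex-L = λ a → trans (vertexDeleted-swap (swap-R a)) (vertexDeleted-R F a)
    ; edge-LL  = λ a b → trans (edgeDeleted-swap (swap-R a) (swap-R b)) (edgeDeleted-RR F a b)
    ; vertex-R = λ b → trans (vertexDeleted-swap (swap-L b))
                             (trans (vertexDeleted-L F b) (cong (λ K → vertexDeleted K b) left≡[]))
    ; edge-RR  = λ a b → trans (edgeDeleted-swap (swap-L a) (swap-L b))
                               (trans (edgeDeleted-LL F a b) (cong (λ K → edgeDeleted K a b) left≡[]))
    ; edge-LR  = λ a b → trans (edgeDeleted-swap (swap-R a) (swap-L b))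
                               (trans (edgeDeleted-sym F (R a) (L b))
                               (trans (edgeDeleted-LR F b a) (cong (λ X → crossDeleted X b a) cross≡[])))
    }
    where
      vertexDeleted-swap : ∀ {x y} → swap x ≡ y → vertexDeleted (mapDel swap F) y ≡ vertexDeleted F x
      vertexDeleted-swap {x} refl = vertexDeleted-map swap swap-injective F x
      edgeDeleted-swap : ∀ {x x′ y y′} → swap x ≡ x′ → swap y ≡ y′ → edgeDeleted (mapDel swap F) x′ y′ ≡ edgeDeleted F x y
      edgeDeleted-swap {x} {y = y} refl refl = edgeDeleted-map swap swap-injective F x y

length≡0⇒[] : ∀ {A : Set} (xs : List A) → length xs ≡ 0 → xs ≡ []
length≡0⇒[] [] _ = refl

overflow-rest : ∀ {a r m} → suc (a + r) ≤ m → ¬ (2 + a ≤ m) → r ≡ 0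
overflow-rest {a} {zero}  _     _     = refl
overflow-rest {a} {suc r} a+r<m 2+a≰m =
  contradiction (ℕ.≤-trans (s≤s (subst (suc a ≤_) (sym (ℕ.+-suc a r)) (s≤s (ℕ.m≤m+n a r)))) a+r<m) 2+a≰m

overflow : ∀ {A : Set} {r m} (xs : List A) → 2 ≤ m → suc (length xs + r) ≤ m → ¬ (2 + length xs ≤ m) →
  r ≡ 0 × Σ A λ x → Σ (List A) λ K → xs ≡ x ∷ K × 2 + length K ≤ m
overflow []           2≤m _   2≰m = contradiction 2≤m 2≰m
overflow {r = r} (x ∷ K) _ xs<m 2+xs≰m =
  overflow-rest xs<m 2+xs≰m , x , K , refl , ℕ.≤-trans (s≤s (s≤s (ℕ.m≤m+n (length K) r))) xs<m

module RobustJoin {m n} (G0 G1 : Graph n) (φ : Fin n ↔ Fin n) (3≤m : 3 ≤ m)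
                  (R₀ : Robust m G0) (R₁ : Robust m G1) where
  open Join G0 G1 φ

  2≤m : 2 ≤ m
  2≤m = ℕ.≤-trans (ℕ.n≤1+n 2) 3≤m

  gluingHeavy : ∀ {F} x K → OnLeftCopy F (x ∷ K) → 2 + length K ≤ m → Gluing F
  gluingHeavy x K onLeft l =
    gluingOnLeft x K onLeft (irreflexive R₀) (survives R₀ K l) (survives R₁ [] 2≤m)
                 (λ u → survives R₁ _ 3≤m) (survives-two-vertices R₁)

robust-⊕ : ∀ {m n} (G0 G1 : Graph n) (φ : Fin n ↔ Fin n) → 3 ≤ m →
  Robust m G0 → Robust m G1 → Robust (suc m) (G0 ⊕[ φ ] G1)
robust-⊕ {m} {n} G0 G1 φ 3≤m R₀ R₁ = record
  { irreflexive = irreflexive-⊕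
  ; survives = survives-⊕
  ; survives-two-vertices = λ u v → survives-⊕ _ (s≤s 3≤m)
  }
  where
    open Join G0 G1 φ
    open Swap G0 G1 φ
    open RobustJoin G0 G1 φ 3≤m R₀ R₁
    module RJ′ = RobustJoin G1 G0 (↔-sym φ) 3≤m R₁ R₀

    irreflexive-⊕ : ∀ x → H x x ≡ false
    irreflexive-⊕ x with side x
    ... | isL a = trans (H-LL a a) (irreflexive R₀ a)
    ... | isR b = trans (H-RR b b) (irreflexive R₁ b)

    module Heavy (F : DelSet (n + n)) (l : 2 + length F ≤ suc m) where
      a b c : ℕ
      a = length (leftPart F)
      b = length (rightPart F)
      c = length (crossPart F)

      parts<m : suc (a + b + c) ≤ m
      parts<m = subst (λ k → suc k ≤ m) (sym (length-parts F)) (s≤s⁻¹ l)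

      leftHeavy : ¬ (2 + a ≤ m) → Gluing F
      leftHeavy 2+a≰m =
        let b+c≡0 , x , K , eq , l′ = overflow (leftPart F) 2≤m (subst (λ k → suc k ≤ m) (ℕ.+-assoc a b c) parts<m) 2+a≰m
            onLeft = onLeftCopy-parts (length≡0⇒[] _ (ℕ.m+n≡0⇒m≡0 b b+c≡0)) (length≡0⇒[] _ (ℕ.m+n≡0⇒n≡0 b b+c≡0))
        in gluingHeavy x K (subst (OnLeftCopy F) eq onLeft) l′

      rightHeavy : ¬ (2 + b ≤ m) → J′.Gluing (mapDel swap F)
      rightHeavy 2+b≰m =
        let a+c≡0 , x , K , eq , l′ = overflow (rightPart F) 2≤m
                                         (subst (λ k → suc k ≤ m) (trans (cong (_+ c) (ℕ.+-comm a b)) (ℕ.+-assoc b a c)) parts<m) 2+b≰m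
            onLeft = onLeftCopy-swapped (length≡0⇒[] _ (ℕ.m+n≡0⇒m≡0 a a+c≡0)) (length≡0⇒[] _ (ℕ.m+n≡0⇒n≡0 a a+c≡0))
        in RJ′.gluingHeavy x K (subst (J′.OnLeftCopy (mapDel swap F)) eq onLeft) l′

    survives-⊕ : ∀ F → 2 + length F ≤ suc m → FracPerfectMatching H F
    survives-⊕ F l with 2 + length (leftPart F) ≤? m | 2 + length (rightPart F) ≤? m
    ... | yes l₀ | yes l₁ =
      glue (gluingDisjoint {K₀ = leftPart F} {K₁ = rightPart F} (vertexDeleted-L F) (vertexDeleted-R F) (live-LL F) (live-RR F)
                           (survives R₀ _ l₀) (survives R₁ _ l₁))
    ... | no 2+a≰m | _       = glue (Heavy.leftHeavy F l 2+a≰m)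
    ... | yes _    | no 2+b≰m = transport swap-≅ (J′.glue (Heavy.rightHeavy F l 2+b≰m))

3≤dimension : ∀ {m k} {G : Graph k} → RHL m G → 3 ≤ m
3≤dimension (base _)         = ℕ.≤-refl
3≤dimension (step r₀ _ _ _) = ℕ.m≤n⇒m≤1+n (3≤dimension r₀)

robust : ∀ {m k} {G : Graph k} → RHL m G → Robust m G
robust (base ι)           = robust-≅ ι robust-G84
robust (step r₀ r₁ φ ι) = robust-≅ ι (robust-⊕ _ _ φ (3≤dimension r₀) (robust r₀) (robust r₁))

-- The upper bound

record SmallStar (m : ℕ) {k} (G : Graph k) : Set where
  field
    centre     : Fin k
    neighbours : List (Fin k)
    few        : length neighbours ≤ m
    adjacent   : All (λ u → G centre u ≡ true) neighbours
    complete   : ∀ u → G centre u ≡ true → u ∈ neighbours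

open SmallStar

smallStar-≅ : ∀ {m k n} {G : Graph k} {H : Graph n} → G ≅ H → SmallStar m H → SmallStar m G
smallStar-≅ {m} {G = G} {H} ι S = record
  { centre     = from c
  ; neighbours = map from (neighbours S)
  ; few        = subst (_≤ m) (sym (length-map from (neighbours S))) (few S)
  ; adjacent   = All.map⁺ (All.map (λ {u} adj → trans (pres (from c) (from u)) (trans (cong₂ H (to∘from c) (to∘from u)) adj))
                                   (adjacent S))
  ; complete   = λ x adj → subst (_∈ map from (neighbours S)) (Inverse.strictlyInverseʳ σ x)
                   (∈-map⁺ from (complete S (to x) (trans (sym (cong₂ H (to∘from c) refl)) (trans (sym (pres (from c) x)) adj))))
  }
  where
    open _≅_ ι
    to = Inverse.to σ
    from = Inverse.from σ
    to∘from = Inverse.strictlyInverseˡ σ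
    c = centre S

smallStar-⊕ : ∀ {m n} (G0 G1 : Graph n) (φ : Fin n ↔ Fin n) → SmallStar m G0 → SmallStar (suc m) (G0 ⊕[ φ ] G1)
smallStar-⊕ G0 G1 φ S = record
  { centre     = L v
  ; neighbours = R (φ⁺ v) ∷ map L (neighbours S)
  ; few        = s≤s (subst (_≤ _) (sym (length-map L (neighbours S))) (few S))
  ; adjacent   = trans (H-LR v (φ⁺ v)) (==-refl (φ⁺ v)) ∷ All.map⁺ (All.map (λ {a} adj → trans (H-LL v a) adj) (adjacent S))
  ; complete   = complete′
  }
  where
    open Join G0 G1 φ
    v = centre S
    complete′ : ∀ x → H (L v) x ≡ true → x ∈ R (φ⁺ v) ∷ map L (neighbours S)
    complete′ x adj with side x
    ... | isL a = there (∈-map⁺ L (complete S a (trans (sym (H-LL v a)) adj)))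
    ... | isR b = here (cong R (sym (==-true⇒≡ (trans (sym (H-LR v b)) adj))))

smallStar-G84 : SmallStar 3 G84
smallStar-G84 = record
  { centre = zero ; neighbours = one ∷ seven ∷ four ∷ [] ; few = ℕ.≤-refl
  ; adjacent = refl ∷ refl ∷ refl ∷ [] ; complete = complete′ }
  where
    one four seven : Fin 8
    one = suc zero
    four = suc (suc (suc (suc zero)))
    seven = suc (suc (suc (suc (suc (suc (suc zero))))))
    complete′ : ∀ u → G84 zero u ≡ true → u ∈ one ∷ seven ∷ four ∷ []
    complete′ zero ()
    complete′ (suc zero) _ = here refl
    complete′ (suc (suc zero)) ()
    complete′ (suc (suc (suc zero))) ()
    complete′ (suc (suc (suc (suc zero)))) _ = there (there (here refl))
    complete′ (suc (suc (suc (suc (suc zero))))) ()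
    complete′ (suc (suc (suc (suc (suc (suc zero)))))) ()
    complete′ (suc (suc (suc (suc (suc (suc (suc zero))))))) _ = there (here refl)

smallStar : ∀ {m k} {G : Graph k} → RHL m G → SmallStar m G
smallStar (base ι)           = smallStar-≅ ι smallStar-G84
smallStar (step r₀ r₁ φ ι) = smallStar-≅ ι (smallStar-⊕ _ _ φ (smallStar r₀))

starCut : ∀ {k} → Fin k → List (Fin k) → DelSet k
starCut v = map (λ u → inj₂ (v , u))

vertexDeleted-starCut : ∀ {k} (v : Fin k) us x → vertexDeleted (starCut v us) x ≡ false
vertexDeleted-starCut v []       x = refl
vertexDeleted-starCut v (_ ∷ us) x = vertexDeleted-starCut v us x

edgeDeleted-starCut : ∀ {k} (v : Fin k) {us u} → u ∈ us → edgeDeleted (starCut v us) v u ≡ true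
edgeDeleted-starCut v {u = u} (here refl) rewrite ==-refl v | ==-refl u = refl
edgeDeleted-starCut v {u ∷ _} (there u∈us) = trans (cong (coversEdge (v , u) v _ ∨_) (edgeDeleted-starCut v u∈us)) (𝔹.∨-zeroʳ _)

smallStar-FSMP : ∀ {m k} {G : Graph k} (S : SmallStar m G) → FSMPSet G (starCut (centre S) (neighbours S))
smallStar-FSMP {G = G} S =
  All.map⁺ (adjacent S) , isolated⇒¬HasFPM G F c (vertexDeleted-starCut c (neighbours S) c) dead-at-centre
  where
    c = centre S
    F = starCut c (neighbours S)

    dead-at-centre : ∀ u → live G F c u ≡ false
    dead-at-centre u = by-adjacency (G c u) refl
      where
        by-adjacency : ∀ b → G c u ≡ b → live G F c u ≡ false
        by-adjacency false no-edge = live-nonEdge G F c u no-edge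
        by-adjacency true  adj     = live-edgeDeleted G F c u (edgeDeleted-starCut c (complete S u adj))

<∸1⇒2+≤ : ∀ {l m} → 1 ≤ m → suc l ≤ m ∸ 1 → 2 + l ≤ m
<∸1⇒2+≤ {m = suc m} _ l<m = s≤s l<m

lemma3p2 : (m : ℕ) → 3 ≤ m → ∀ {k} (G : Graph k) → RHL m G →
    (Σ (DelSet k) λ F → FSMPSet G F × length F ≤ m)
    × (∀ (F : DelSet k) → FSMPSet G F → m ∸ 1 ≤ length F)
lemma3p2 m 3≤m G rhl = upper , lower
  where
    S = smallStar rhl

    upper : Σ (DelSet _) λ F → FSMPSet G F × length F ≤ m
    upper = starCut (centre S) (neighbours S) , smallStar-FSMP S
          , subst (_≤ m) (sym (length-map _ (neighbours S))) (few S)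

    lower : ∀ F → FSMPSet G F → m ∸ 1 ≤ length F
    lower F (_ , no-fpm) with m ∸ 1 ≤? length F
    ... | yes bound = bound
    ... | no  short =
      contradiction (toHasFPM (survives (robust rhl) F (<∸1⇒2+≤ (ℕ.≤-trans (s≤s z≤n) 3≤m) (ℕ.≰⇒> short)))) no-fpm
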